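{- Let $G$ be a finite graph, $k$ an integer, $M$ a module of $G$, and $S,T$ two independent sets of $G$ with $S\cap M=T\cap M=\emptyset$. Let $A$ be a maximum independent set of $G[M]$. Then for every $u\in M\setminus A$: $S\leftrightsquigarrow_k T$ in $G$ if and only if $S\leftrightsquigarrow_k T$ in $G-u$.
   Context: For a graph $H$, independent sets $S,S'$ and an integer $k$, write $S\leftrightarrow_k S'$ if $|S\triangle S'|\le 1$ and $\min\{|S|,|S'|\}\ge k$. Write $S\leftrightsquigarrow_k S'$ in $H$ if there exist $\ell\ge 0$ and independent sets $S_0=S,\dots,S_\ell=S'$ of $H$ with $S_{i-1}\leftrightarrow_k S_i$ for all $i$. A module of $G=(V,E)$ is a set $M\subseteq V$ such that every vertex of $V\setminus M$ is adjacent to all or to none of the vertices of $M$. -}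

module Defs where

open import Data.Nat using (ℕ; _⊓_)
open import Data.Integer using (ℤ; +_) renaming (_≤_ to _≤ℤ_)
open import Data.Nat as N using (_≤_)
open import Data.Bool using (Bool; true; false; T)
open import Data.Fin using (Fin)
open import Data.Fin.Subset using (Subset; ⊤; _∈_; _∉_; _⊆_; _∪_; _─_; ∁; ⁅_⁆; ∣_∣; Empty; _∩_)
open import Data.Product using (_×_)
open import Data.Sum using (_⊎_)
open import Relation.Binary.PropositionalEquality using (_≡_)
open import Relation.Nullary using (¬_)

record Graph (n : ℕ) : Set where
  field
    adj    : Fin n → Fin n → Bool
    sym    : ∀ u v → adj u v ≡ adj v u
    irrefl : ∀ v → adj v v ≡ false
open Graph public

module _ {n : ℕ} (G : Graph n) where

  Independent : Subset n → Set
  Independent S = ∀ u v → u ∈ S → v ∈ S → adj G u v ≡ false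

  IsModule : Subset n → Set
  IsModule M = ∀ v → v ∉ M →
    (∀ m → m ∈ M → adj G v m ≡ true) ⊎ (∀ m → m ∈ M → adj G v m ≡ false)

  MaximumIndependentIn : Subset n → Subset n → Set
  MaximumIndependentIn M A =
    A ⊆ M × Independent A × (∀ B → B ⊆ M → Independent B → ∣ B ∣ ≤ ∣ A ∣)

  _△_ : Subset n → Subset n → Subset n
  S △ S' = (S ─ S') ∪ (S' ─ S)

  Step : ℤ → Subset n → Subset n → Set
  Step k S S' = ∣ S △ S' ∣ ≤ 1 × k ≤ℤ + (∣ S ∣ ⊓ ∣ S' ∣)

  IndIn : Subset n → Subset n → Set
  IndIn W S = S ⊆ W × Independent S

  -- S ⇝_k T in the induced subgraph G[W]: a sequence S = S₀, …, S_ℓ = T (ℓ ≥ 0)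
  -- of independent sets of G[W] with consecutive sets related by Step k.
  data Reach (W : Subset n) (k : ℤ) : Subset n → Subset n → Set where
    here : ∀ {S} → IndIn W S → Reach W k S S
    step : ∀ {S S' T} → IndIn W S → Step k S S' → Reach W k S' T → Reach W k S T

  ReachG : ℤ → Subset n → Subset n → Set
  ReachG k = Reach ⊤ k

  -- reachability in G - u, the induced subgraph on V ∖ {u}
  ReachMinus : Fin n → ℤ → Subset n → Subset n → Set
  ReachMinus u k = Reach (∁ ⁅ u ⁆) k

module Submission where

-- A sequence in G - u is one in G; for the converse, project every set of a
-- sequence S = I₀, …, I_ℓ = T of G (ends avoiding M): π(I) = I if I avoids M,
-- otherwise π(I) = (I ∖ M) ∪ A.  As M is a module, a vertex outside M missing
-- one vertex of M misses all of M, so π(I) is independent; maximality of A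
-- gives |π(I)| ≥ |I|; and π(I) avoids u.  A step I → I' becomes π(I) ⇝ π(I'):
-- if both sets meet M, then π(I) △ π(I') ⊆ I △ I'; if neither does, the step
-- is kept; if only I' does, then I' = I + m with m ∈ M and π(I') = I ∪ A is
-- reached from I by adding A vertex by vertex (symmetrically for I).

open import Defs hiding (sym; _△_)
import Defs as D
open import Data.Nat using (ℕ; zero; suc; _+_; _⊓_; _≤_)
import Data.Nat.Properties as ℕₚ
open import Data.Integer using (ℤ; +_; +≤+) renaming (_≤_ to _≤ℤ_)
import Data.Integer.Properties as ℤₚ
open import Data.Bool using (true; false)
open import Data.Fin using (Fin; zero; suc; _≟_)
open import Data.Fin.Subset
open import Data.Fin.Subset.Properties
open import Data.Vec using ([]; _∷_; here; there)
open import Data.Product using (_×_; _,_; proj₁; proj₂)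
open import Data.Sum using (inj₁; inj₂)
open import Data.Empty using (⊥-elim)
open import Relation.Nullary using (yes; no)
open import Relation.Binary.PropositionalEquality as ≡ using (_≡_; _≢_; refl; cong; subst)
open import Function.Bundles using (_⇔_; mk⇔)
open import Function using (case_of_)

-- Symmetric difference; the same set as Defs' graph-indexed _△_, which does
-- not actually depend on the graph.
_△_ : ∀ {n} → Subset n → Subset n → Subset n
S △ S' = (S ─ S') ∪ (S' ─ S)

x∈p─q⁻ : ∀ {n} {x : Fin n} (p q : Subset n) → x ∈ p ─ q → x ∈ p × x ∉ q
x∈p─q⁻ (true ∷ p) (false ∷ q) here = here , λ ()
x∈p─q⁻ {x = zero} (true ∷ p) (true ∷ q) ()
x∈p─q⁻ {x = zero} (false ∷ p) (true ∷ q) ()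
x∈p─q⁻ {x = zero} (false ∷ p) (false ∷ q) ()
x∈p─q⁻ {x = suc x} (s ∷ p) (t ∷ q) x∈ with x∈p─q⁻ p q (drop-there x∈)
... | x∈p , x∉q = there x∈p , λ x∈ → x∉q (drop-there x∈)

x∈p⇒1≤∣p∣ : ∀ {n} {x : Fin n} {p : Subset n} → x ∈ p → 1 ≤ ∣ p ∣
x∈p⇒1≤∣p∣ {x = x} {p} x∈p = subst (_≤ ∣ p ∣) (∣⁅x⁆∣≡1 x)
  (p⊆q⇒∣p∣≤∣q∣ λ {y} y∈⁅x⁆ → subst (_∈ p) (≡.sym (x∈⁅y⁆⇒x≡y x y∈⁅x⁆)) x∈p)

∣p∣≤1⇒unique : ∀ {n} {x y : Fin n} {p : Subset n} → ∣ p ∣ ≤ 1 → x ∈ p → y ∈ p → x ≡ y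
∣p∣≤1⇒unique {x = x} {y} {p} ∣p∣≤1 x∈p y∈p with x ≟ y
... | yes x≡y = x≡y
... | no x≢y = ⊥-elim (ℕₚ.<-irrefl refl (begin-strict
      1             ≤⟨ x∈p⇒1≤∣p∣ (x∈p∧x≢y⇒x∈p-y y∈p λ y≡x → x≢y (≡.sym y≡x)) ⟩
      ∣ p - x ∣     <⟨ x∈p⇒∣p-x∣<∣p∣ x∈p ⟩
      ∣ p ∣         ≤⟨ ∣p∣≤1 ⟩
      1             ∎))
  where open ℕₚ.≤-Reasoning

∣p─q∣+∣p∩q∣≡∣p∣ : ∀ {n} (p q : Subset n) → ∣ p ─ q ∣ + ∣ p ∩ q ∣ ≡ ∣ p ∣
∣p─q∣+∣p∩q∣≡∣p∣ [] [] = refl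
∣p─q∣+∣p∩q∣≡∣p∣ (true ∷ p) (true ∷ q) = ≡.trans (ℕₚ.+-suc _ _) (cong suc (∣p─q∣+∣p∩q∣≡∣p∣ p q))
∣p─q∣+∣p∩q∣≡∣p∣ (true ∷ p) (false ∷ q) = cong suc (∣p─q∣+∣p∩q∣≡∣p∣ p q)
∣p─q∣+∣p∩q∣≡∣p∣ (false ∷ p) (true ∷ q) = ∣p─q∣+∣p∩q∣≡∣p∣ p q
∣p─q∣+∣p∩q∣≡∣p∣ (false ∷ p) (false ∷ q) = ∣p─q∣+∣p∩q∣≡∣p∣ p q

∣p∪q∣+∣p∩q∣≡∣p∣+∣q∣ : ∀ {n} (p q : Subset n) → ∣ p ∪ q ∣ + ∣ p ∩ q ∣ ≡ ∣ p ∣ + ∣ q ∣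
∣p∪q∣+∣p∩q∣≡∣p∣+∣q∣ [] [] = refl
∣p∪q∣+∣p∩q∣≡∣p∣+∣q∣ (true ∷ p) (true ∷ q) =
  cong suc (≡.trans (ℕₚ.+-suc _ _) (≡.trans (cong suc (∣p∪q∣+∣p∩q∣≡∣p∣+∣q∣ p q)) (≡.sym (ℕₚ.+-suc _ _))))
∣p∪q∣+∣p∩q∣≡∣p∣+∣q∣ (true ∷ p) (false ∷ q) = cong suc (∣p∪q∣+∣p∩q∣≡∣p∣+∣q∣ p q)
∣p∪q∣+∣p∩q∣≡∣p∣+∣q∣ (false ∷ p) (true ∷ q) =
  ≡.trans (cong suc (∣p∪q∣+∣p∩q∣≡∣p∣+∣q∣ p q)) (≡.sym (ℕₚ.+-suc _ _))
∣p∪q∣+∣p∩q∣≡∣p∣+∣q∣ (false ∷ p) (false ∷ q) = ∣p∪q∣+∣p∩q∣≡∣p∣+∣q∣ p q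

disjoint⇒∣p∪q∣≡∣p∣+∣q∣ : ∀ {n} (p q : Subset n) → Empty (p ∩ q) → ∣ p ∪ q ∣ ≡ ∣ p ∣ + ∣ q ∣
disjoint⇒∣p∪q∣≡∣p∣+∣q∣ {n} p q disjoint = begin
  ∣ p ∪ q ∣               ≡⟨ ≡.sym (ℕₚ.+-identityʳ _) ⟩
  ∣ p ∪ q ∣ + 0           ≡⟨ cong (λ X → ∣ p ∪ q ∣ + X) (≡.sym (∣⊥∣≡0 n)) ⟩
  ∣ p ∪ q ∣ + ∣ ⊥ {n} ∣   ≡⟨ cong (λ X → ∣ p ∪ q ∣ + ∣ X ∣) (≡.sym (Empty-unique disjoint)) ⟩
  ∣ p ∪ q ∣ + ∣ p ∩ q ∣   ≡⟨ ∣p∪q∣+∣p∩q∣≡∣p∣+∣q∣ p q ⟩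
  ∣ p ∣ + ∣ q ∣           ∎
  where open ≡.≡-Reasoning

∣p△q∣≤1-insert : ∀ {n} {x : Fin n} {p q : Subset n} → p ⊆ q → q ⊆ p ∪ ⁅ x ⁆ → ∣ p △ q ∣ ≤ 1
∣p△q∣≤1-insert {x = x} {p} {q} p⊆q q⊆p+x =
  ℕₚ.≤-trans (p⊆q⇒∣p∣≤∣q∣ p△q⊆⁅x⁆) (ℕₚ.≤-reflexive (∣⁅x⁆∣≡1 x))
  where
  p△q⊆⁅x⁆ : p △ q ⊆ ⁅ x ⁆
  p△q⊆⁅x⁆ y∈ with x∈p∪q⁻ (p ─ q) (q ─ p) y∈
  ... | inj₁ y∈p─q = let (y∈p , y∉q) = x∈p─q⁻ p q y∈p─q in ⊥-elim (y∉q (p⊆q y∈p))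
  ... | inj₂ y∈q─p with x∈p─q⁻ q p y∈q─p
  ... | y∈q , y∉p with x∈p∪q⁻ p ⁅ x ⁆ (q⊆p+x y∈q)
  ...   | inj₁ y∈p = ⊥-elim (y∉p y∈p)
  ...   | inj₂ y∈⁅x⁆ = y∈⁅x⁆

-- If S and S' differ in at most one element, S avoids M and m ∈ S' ∩ M, then
-- that element is m, so removing M from S' gives back S.
exchange : ∀ {n} {S S' M : Subset n} {m : Fin n} → ∣ S △ S' ∣ ≤ 1 → Empty (S ∩ M) →
           m ∈ S' → m ∈ M → S' ─ M ≡ S
exchange {S = S} {S'} {M} {m} ∣S△S'∣≤1 S∩M=∅ m∈S' m∈M = ⊆-antisym S'─M⊆S S⊆S'─M
  where
  m∈S△S' : m ∈ S △ S'
  m∈S△S' = q⊆p∪q (S ─ S') (S' ─ S)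
    (x∈p∧x∉q⇒x∈p─q m∈S' λ m∈S → S∩M=∅ (m , x∈p∩q⁺ (m∈S , m∈M)))
  △⊆M : ∀ {x} → x ∈ S △ S' → x ∈ M
  △⊆M x∈ = subst (_∈ M) (∣p∣≤1⇒unique ∣S△S'∣≤1 m∈S△S' x∈) m∈M
  S'─M⊆S : S' ─ M ⊆ S
  S'─M⊆S {x} x∈ with x∈p─q⁻ S' M x∈ | x ∈? S
  ... | _ , _ | yes x∈S = x∈S
  ... | x∈S' , x∉M | no x∉S = ⊥-elim (x∉M (△⊆M (q⊆p∪q (S ─ S') (S' ─ S) (x∈p∧x∉q⇒x∈p─q x∈S' x∉S))))
  S⊆S'─M : S ⊆ S' ─ M
  S⊆S'─M {x} x∈S with x ∈? S'
  ... | yes x∈S' = x∈p∧x∉q⇒x∈p─q x∈S' λ x∈M → S∩M=∅ (x , x∈p∩q⁺ (x∈S , x∈M))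
  ... | no x∉S' = ⊥-elim (S∩M=∅ (x , x∈p∩q⁺ (x∈S , △⊆M (p⊆p∪q (S' ─ S) (x∈p∧x∉q⇒x∈p─q x∈S x∉S')))))

module Sequences {n : ℕ} (G : Graph n) {W : Subset n} {k : ℤ} where

  reach-last : ∀ {S T} → Reach G W k S T → IndIn G W T
  reach-last (here i) = i
  reach-last (step _ _ r) = reach-last r

  reach-first : ∀ {S T} → Reach G W k S T → IndIn G W S
  reach-first (here i) = i
  reach-first (step i _ _) = i

  _++_ : ∀ {S T U} → Reach G W k S T → Reach G W k T U → Reach G W k S U
  here _ ++ r = r
  step i s r ++ r' = step i s (r ++ r')

  _∷ʳ_ : ∀ {S T U} → Reach G W k S T → Step G k T U × IndIn G W U → Reach G W k S U
  r ∷ʳ (s , i) = r ++ step (reach-last r) s (here i)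

  step-sym : ∀ {S S'} → Step G k S S' → Step G k S' S
  step-sym {S} {S'} (∣△∣≤1 , k≤min) =
    subst (λ X → ∣ X ∣ ≤ 1) (∪-comm (S ─ S') (S' ─ S)) ∣△∣≤1 ,
    subst (λ X → k ≤ℤ + X) (ℕₚ.⊓-comm ∣ S ∣ ∣ S' ∣) k≤min

  reverse : ∀ {S T} → Reach G W k S T → Reach G W k T S
  reverse (here i) = here i
  reverse (step {S} {S'} i s r) = reverse r ∷ʳ (step-sym {S} {S'} s , i)

  -- Growing: if P ∪ B is independent in G[W] and already |P| ≥ k, then P
  -- reaches P ∪ B by adding the vertices of B one at a time (all intermediate
  -- sets contain P, so they stay large enough).
  grow-by : ∀ (c : ℕ) (P B : Subset n) → ∣ B ∣ ≤ c → IndIn G W (P ∪ B) →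
            k ≤ℤ + ∣ P ∣ → Reach G W k P (P ∪ B)
  grow-by c P B _ (P∪B⊆W , indP∪B) k≤∣P∣ with nonempty? B
  ... | no B=∅ = subst (Reach G W k P) (≡.sym P∪B≡P) (here (P⊆W , indP))
    where
    P∪B≡P : P ∪ B ≡ P
    P∪B≡P = ≡.trans (cong (P ∪_) (Empty-unique B=∅)) (∪-identityʳ P)
    P⊆W : P ⊆ W
    P⊆W x∈ = P∪B⊆W (p⊆p∪q B x∈)
    indP : Independent G P
    indP x y x∈ y∈ = indP∪B x y (p⊆p∪q B x∈) (p⊆p∪q B y∈)
  grow-by zero P B ∣B∣≤0 _ _ | yes (x , x∈B) = case ℕₚ.≤-trans (x∈p⇒1≤∣p∣ x∈B) ∣B∣≤0 of λ ()
  grow-by (suc c) P B ∣B∣≤c+1 (P∪B⊆W , indP∪B) k≤∣P∣ | yes (x , x∈B) =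
    grow-by c P (B - x) ∣B-x∣≤c
      ((λ y∈ → P∪B⊆W (smaller⊆ y∈)) , λ a b a∈ b∈ → indP∪B a b (smaller⊆ a∈) (smaller⊆ b∈)) k≤∣P∣
      ∷ʳ ((∣p△q∣≤1-insert smaller⊆ bigger⊆ , k≤min) , (P∪B⊆W , indP∪B))
    where
    ∣B-x∣≤c : ∣ B - x ∣ ≤ c
    ∣B-x∣≤c = ℕₚ.≤-pred (ℕₚ.≤-trans (x∈p⇒∣p-x∣<∣p∣ x∈B) ∣B∣≤c+1)
    smaller⊆ : P ∪ (B - x) ⊆ P ∪ B
    smaller⊆ y∈ with x∈p∪q⁻ P (B - x) y∈
    ... | inj₁ y∈P = p⊆p∪q B y∈P
    ... | inj₂ y∈B-x = q⊆p∪q P B (p─q⊆p B ⁅ x ⁆ y∈B-x)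
    bigger⊆ : P ∪ B ⊆ (P ∪ (B - x)) ∪ ⁅ x ⁆
    bigger⊆ {y} y∈ with x∈p∪q⁻ P B y∈ | y ≟ x
    ... | inj₁ y∈P | _ = p⊆p∪q ⁅ x ⁆ (p⊆p∪q (B - x) y∈P)
    ... | inj₂ _ | yes y≡x = q⊆p∪q (P ∪ (B - x)) ⁅ x ⁆ (subst (_∈ ⁅ x ⁆) (≡.sym y≡x) (x∈⁅x⁆ x))
    ... | inj₂ y∈B | no y≢x = p⊆p∪q ⁅ x ⁆ (q⊆p∪q P (B - x) (x∈p∧x≢y⇒x∈p-y y∈B y≢x))
    k≤min : k ≤ℤ + (∣ P ∪ (B - x) ∣ ⊓ ∣ P ∪ B ∣)
    k≤min = ℤₚ.≤-trans k≤∣P∣ (+≤+ (ℕₚ.⊓-glb (∣p∣≤∣p∪q∣ P (B - x)) (∣p∣≤∣p∪q∣ P B)))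

  grow : ∀ (P B : Subset n) → IndIn G W (P ∪ B) → k ≤ℤ + ∣ P ∣ → Reach G W k P (P ∪ B)
  grow P B = grow-by n P B (∣p∣≤n B)

  widen : ∀ {W'} {S T} → W ⊆ W' → Reach G W k S T → Reach G W' k S T
  widen W⊆W' (here (S⊆W , indS)) = here ((λ x∈ → W⊆W' (S⊆W x∈)) , indS)
  widen W⊆W' (step (S⊆W , indS) s r) = step ((λ x∈ → W⊆W' (S⊆W x∈)) , indS) s (widen W⊆W' r)

module Filling {n : ℕ} (G : Graph n) (M A : Subset n)
  (isModule : IsModule G M) (maxA : MaximumIndependentIn G M A) where

  A⊆M : A ⊆ M
  A⊆M = proj₁ maxA

  fill : Subset n → Subset n
  fill I = (I ─ M) ∪ A

  module-nonadjacent : ∀ v → v ∉ M → ∀ {m} → m ∈ M → adj G v m ≡ false →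
                       ∀ m' → m' ∈ M → adj G v m' ≡ false
  module-nonadjacent v v∉M m∈M v≁m with isModule v v∉M
  ... | inj₁ allAdjacent = case ≡.trans (≡.sym (allAdjacent _ m∈M)) v≁m of λ ()
  ... | inj₂ noneAdjacent = noneAdjacent

  -- If an independent set I meets M, its vertices outside M are non-adjacent
  -- to a vertex of M, hence to all of M, in particular to A.
  outside-misses-A : ∀ I → Independent G I → Nonempty (I ∩ M) →
                     ∀ {v} → v ∈ I ─ M → ∀ a → a ∈ A → adj G v a ≡ false
  outside-misses-A I indI (m , m∈I∩M) {v} v∈I─M a a∈A =
    let (v∈I , v∉M) = x∈p─q⁻ I M v∈I─M
        (m∈I , m∈M) = x∈p∩q⁻ I M m∈I∩M
    in module-nonadjacent v v∉M m∈M (indI v m v∈I m∈I) a (A⊆M a∈A)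

  fill-independent : ∀ I → Independent G I → Nonempty (I ∩ M) → Independent G (fill I)
  fill-independent I indI I∩M≠∅ x y x∈ y∈
    with x∈p∪q⁻ (I ─ M) A x∈ | x∈p∪q⁻ (I ─ M) A y∈
  ... | inj₁ x∈I─M | inj₁ y∈I─M = indI x y (proj₁ (x∈p─q⁻ I M x∈I─M)) (proj₁ (x∈p─q⁻ I M y∈I─M))
  ... | inj₂ x∈A | inj₂ y∈A = proj₁ (proj₂ maxA) x y x∈A y∈A
  ... | inj₁ x∈I─M | inj₂ y∈A = outside-misses-A I indI I∩M≠∅ x∈I─M y y∈A
  ... | inj₂ x∈A | inj₁ y∈I─M = ≡.trans (D.sym G x y) (outside-misses-A I indI I∩M≠∅ y∈I─M x x∈A)

  -- Filling does not shrink an independent set: |I ∩ M| ≤ |A| by maximality.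
  fill-size : ∀ I → Independent G I → ∣ I ∣ ≤ ∣ fill I ∣
  fill-size I indI = begin
    ∣ I ∣                    ≡⟨ ≡.sym (∣p─q∣+∣p∩q∣≡∣p∣ I M) ⟩
    ∣ I ─ M ∣ + ∣ I ∩ M ∣    ≤⟨ ℕₚ.+-monoʳ-≤ ∣ I ─ M ∣ ∣I∩M∣≤∣A∣ ⟩
    ∣ I ─ M ∣ + ∣ A ∣        ≡⟨ ≡.sym (disjoint⇒∣p∪q∣≡∣p∣+∣q∣ (I ─ M) A disjoint) ⟩
    ∣ fill I ∣               ∎
    where
    open ℕₚ.≤-Reasoning
    ∣I∩M∣≤∣A∣ : ∣ I ∩ M ∣ ≤ ∣ A ∣
    ∣I∩M∣≤∣A∣ = proj₂ (proj₂ maxA) (I ∩ M) (λ x∈ → proj₂ (x∈p∩q⁻ I M x∈))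
      λ x y x∈ y∈ → indI x y (proj₁ (x∈p∩q⁻ I M x∈)) (proj₁ (x∈p∩q⁻ I M y∈))
    disjoint : Empty ((I ─ M) ∩ A)
    disjoint (x , x∈) = let (x∈I─M , x∈A) = x∈p∩q⁻ (I ─ M) A x∈
                        in proj₂ (x∈p─q⁻ I M x∈I─M) (A⊆M x∈A)

  -- Filling does not enlarge symmetric differences: a vertex in one filled
  -- set but not the other cannot lie in A, so it comes from the original sets.
  fill-─ : ∀ I I' {x} → x ∈ fill I ─ fill I' → x ∈ I ─ I'
  fill-─ I I' x∈ with x∈p─q⁻ (fill I) (fill I') x∈
  ... | x∈fillI , x∉fillI' with x∈p∪q⁻ (I ─ M) A x∈fillI
  ... | inj₂ x∈A = ⊥-elim (x∉fillI' (q⊆p∪q (I' ─ M) A x∈A))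
  ... | inj₁ x∈I─M = let (x∈I , x∉M) = x∈p─q⁻ I M x∈I─M in
    x∈p∧x∉q⇒x∈p─q x∈I λ x∈I' → x∉fillI' (p⊆p∪q A (x∈p∧x∉q⇒x∈p─q x∈I' x∉M))

  fill-△ : ∀ I I' → fill I △ fill I' ⊆ I △ I'
  fill-△ I I' x∈ with x∈p∪q⁻ (fill I ─ fill I') (fill I' ─ fill I) x∈
  ... | inj₁ x∈fillI─fillI' = p⊆p∪q (I' ─ I) (fill-─ I I' x∈fillI─fillI')
  ... | inj₂ x∈fillI'─fillI = q⊆p∪q (I ─ I') (I' ─ I) (fill-─ I' I x∈fillI'─fillI)

module Projection {n : ℕ} (G : Graph n) (k : ℤ) (M A : Subset n)
  (isModule : IsModule G M) (maxA : MaximumIndependentIn G M A)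
  (W : Subset n) (outside⊆W : ∀ {x} → x ∉ M → x ∈ W) (A⊆W : A ⊆ W) where

  open Filling G M A isModule maxA
  open Sequences G {W} {k}

  project : Subset n → Subset n
  project I with nonempty? (I ∩ M)
  ... | yes _ = fill I
  ... | no _ = I

  project-avoiding : ∀ I → Empty (I ∩ M) → project I ≡ I
  project-avoiding I I∩M=∅ with nonempty? (I ∩ M)
  ... | yes I∩M≠∅ = ⊥-elim (I∩M=∅ I∩M≠∅)
  ... | no _ = refl

  avoiding⊆W : ∀ I → Empty (I ∩ M) → I ⊆ W
  avoiding⊆W I I∩M=∅ {x} x∈I = outside⊆W λ x∈M → I∩M=∅ (x , x∈p∩q⁺ (x∈I , x∈M))

  fill⊆W : ∀ I → fill I ⊆ W
  fill⊆W I x∈ with x∈p∪q⁻ (I ─ M) A x∈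
  ... | inj₁ x∈I─M = outside⊆W (proj₂ (x∈p─q⁻ I M x∈I─M))
  ... | inj₂ x∈A = A⊆W x∈A

  fill-in-W : ∀ I → Independent G I → Nonempty (I ∩ M) → IndIn G W (fill I)
  fill-in-W I indI I∩M≠∅ = fill⊆W I , fill-independent I indI I∩M≠∅

  fill-step : ∀ I I' → Independent G I → Independent G I' → Step G k I I' → Step G k (fill I) (fill I')
  fill-step I I' indI indI' (∣I△I'∣≤1 , k≤min) =
    ℕₚ.≤-trans (p⊆q⇒∣p∣≤∣q∣ (fill-△ I I')) ∣I△I'∣≤1 ,
    ℤₚ.≤-trans k≤min (+≤+ (ℕₚ.⊓-mono-≤ (fill-size I indI) (fill-size I' indI')))

  -- Entering M: if I avoids M and the step I → I' adds a vertex of M, then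
  -- fill I' = I ∪ A, which is reached from I by adding A vertex by vertex.
  enter : ∀ I I' → Independent G I' → Step G k I I' → Empty (I ∩ M) → Nonempty (I' ∩ M) →
          Reach G W k I (fill I')
  enter I I' indI' (∣I△I'∣≤1 , k≤min) I∩M=∅ I'∩M≠∅@(m , m∈I'∩M) =
    subst (Reach G W k I) (≡.sym fillI'≡I∪A)
      (grow I A (subst (IndIn G W) fillI'≡I∪A (fill-in-W I' indI' I'∩M≠∅))
        (ℤₚ.≤-trans k≤min (+≤+ (ℕₚ.m⊓n≤m ∣ I ∣ ∣ I' ∣))))
    where
    fillI'≡I∪A : fill I' ≡ I ∪ A
    fillI'≡I∪A = let (m∈I' , m∈M) = x∈p∩q⁻ I' M m∈I'∩M in
      cong (_∪ A) (exchange ∣I△I'∣≤1 I∩M=∅ m∈I' m∈M)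

  project-step : ∀ I I' → Independent G I → Independent G I' → Step G k I I' →
                 Reach G W k (project I) (project I')
  project-step I I' indI indI' I→I' with nonempty? (I ∩ M) | nonempty? (I' ∩ M)
  ... | no I∩M=∅ | no I'∩M=∅ =
    step (avoiding⊆W I I∩M=∅ , indI) I→I' (here (avoiding⊆W I' I'∩M=∅ , indI'))
  ... | yes I∩M≠∅ | yes I'∩M≠∅ =
    step (fill-in-W I indI I∩M≠∅) (fill-step I I' indI indI' I→I') (here (fill-in-W I' indI' I'∩M≠∅))
  ... | no I∩M=∅ | yes I'∩M≠∅ = enter I I' indI' I→I' I∩M=∅ I'∩M≠∅
  ... | yes I∩M≠∅ | no I'∩M=∅ = reverse (enter I' I indI (step-sym {I} {I'} I→I') I'∩M=∅ I∩M≠∅)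

  project-walk : ∀ {S T} → ReachG G k S T → Empty (T ∩ M) → Reach G W k (project S) T
  project-walk {T = T} (here (_ , indT)) T∩M=∅ =
    subst (λ X → Reach G W k X T) (≡.sym (project-avoiding T T∩M=∅)) (here (avoiding⊆W T T∩M=∅ , indT))
  project-walk {S} (step {S' = S'} (_ , indS) S→S' S'⇝T) T∩M=∅ =
    project-step S S' indS (proj₂ (Sequences.reach-first G S'⇝T)) S→S' ++ project-walk S'⇝T T∩M=∅

  reach-inside : ∀ {S T} → Empty (S ∩ M) → Empty (T ∩ M) → ReachG G k S T → Reach G W k S T
  reach-inside {S} {T} S∩M=∅ T∩M=∅ S⇝T =
    subst (λ X → Reach G W k X T) (project-avoiding S S∩M=∅) (project-walk S⇝T T∩M=∅)

lemma5 : (n : ℕ) (G : Graph n) (k : ℤ) (M S T A : Subset n) →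
         IsModule G M → Independent G S → Independent G T →
         Empty (S ∩ M) → Empty (T ∩ M) →
         MaximumIndependentIn G M A →
         (u : Fin n) → u ∈ M → u ∉ A →
         ReachG G k S T ⇔ ReachMinus G u k S T
lemma5 n G k M S T A isModule _ _ S∩M=∅ T∩M=∅ maxA u u∈M u∉A =
  mk⇔ (Projection.reach-inside G k M A isModule maxA (∁ ⁅ u ⁆) outside⊆G-u A⊆G-u S∩M=∅ T∩M=∅)
      (Sequences.widen G (λ _ → ∈⊤))
  where
  ≢u⇒∈G-u : ∀ {x} → x ≢ u → x ∈ ∁ ⁅ u ⁆
  ≢u⇒∈G-u x≢u = x∉p⇒x∈∁p (x≢y⇒x∉⁅y⁆ x≢u)
  outside⊆G-u : ∀ {x} → x ∉ M → x ∈ ∁ ⁅ u ⁆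
  outside⊆G-u x∉M = ≢u⇒∈G-u λ x≡u → x∉M (subst (_∈ M) (≡.sym x≡u) u∈M)
  A⊆G-u : A ⊆ ∁ ⁅ u ⁆
  A⊆G-u x∈A = ≢u⇒∈G-u λ x≡u → u∉A (subst (_∈ A) x≡u x∈A)
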